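{- For all positive integers $n$ and all integers $k>1$, \[\left\lfloor \sqrt[k]{2^k n+2^{k-1}-1}\right\rfloor=\left\lfloor \sqrt[k]{2^k n+2^{k-1}}\right\rfloor .\]
   Context: $\lfloor y\rfloor$ denotes the greatest integer less than or equal to $y$; $\sqrt[k]{\cdot}$ is the real positive $k$-th root. -}

module Defs where

open import Data.Nat using (ℕ; zero; suc; _+_; _*_; _∸_; _^_; _≤_; _≤ᵇ_)
open import Data.Bool using (if_then_else_)

rootSearch : ℕ → ℕ → ℕ → ℕ
rootSearch k x zero = zero
rootSearch k x (suc m) = if suc m ^ k ≤ᵇ x then suc m else rootSearch k x m

-- floorRoot k x = ⌊ x^(1/k) ⌋ for k ≥ 1, i.e. the greatest natural r with r ^ k ≤ x.
-- (Any such r satisfies r ≤ x when k ≥ 1, so searching below x suffices.)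
floorRoot : ℕ → ℕ → ℕ
floorRoot k x = rootSearch k x x

{-# OPTIONS --safe #-}
-- ⌊ x^(1/k) ⌋ can only jump when x passes a perfect k-th power, so it suffices that
-- N = 2^k n + 2^(k-1) = 2^(k-1) (2n+1) is not a k-th power: if j^k = N then 2 ∣ j,
-- hence 2^k ∣ N, contradicting the oddness of 2n+1. The argument does not need n ≥ 1.
module Submission where

open import Defs
open import Data.Nat using (ℕ; zero; suc; _+_; _*_; _∸_; _^_; _<_; _≤_; _≰_; _≤ᵇ_; s≤s; z≤n)
open import Data.Nat.Properties
open import Data.Nat.Divisibility using (_∣_; divides; ∣1⇒≡1; ∣m⇒∣m*n; m∣m*n)
open import Data.Nat.Primality using (Prime; prime[2]; ¬prime[1]; euclidsLemma)
open import Data.Nat.Solver using (module +-*-Solver)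
open import Data.Bool using (true; false)
open import Data.Sum using ([_,_])
open import Function using (id)
open import Relation.Binary.PropositionalEquality using (_≡_; _≢_; refl; sym; trans; cong; subst; module ≡-Reasoning)
open import Relation.Nullary using (yes; no; contradiction)

open +-*-Solver

rootSearch-accept : ∀ k x m → suc m ^ k ≤ x → rootSearch k x (suc m) ≡ suc m
rootSearch-accept k x m le with suc m ^ k ≤ᵇ x | ≤⇒≤ᵇ le
... | true  | _  = refl
... | false | ()

rootSearch-reject : ∀ k x m → suc m ^ k ≰ x → rootSearch k x (suc m) ≡ rootSearch k x m
rootSearch-reject k x m nle with suc m ^ k ≤ᵇ x | ≤ᵇ⇒≤ (suc m ^ k) x
... | false | _     = refl
... | true  | sound = contradiction (sound _) nle

rootSearch-suc : ∀ k x m → (∀ j → j ^ k ≢ suc x) → rootSearch k x m ≡ rootSearch k (suc x) m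
rootSearch-suc k x zero _ = refl
rootSearch-suc k x (suc m) nonPower with suc m ^ k ≤? x
... | yes le = trans (rootSearch-accept k x m le) (sym (rootSearch-accept k (suc x) m (m≤n⇒m≤1+n le)))
... | no nle = begin
  rootSearch k x (suc m)       ≡⟨ rootSearch-reject k x m nle ⟩
  rootSearch k x m             ≡⟨ rootSearch-suc k x m nonPower ⟩
  rootSearch k (suc x) m       ≡⟨ sym (rootSearch-reject k (suc x) m nle′) ⟩
  rootSearch k (suc x) (suc m) ∎
  where
  open ≡-Reasoning
  nle′ : suc m ^ k ≰ suc x
  nle′ le = nonPower (suc m) (≤-antisym le (≰⇒> nle))

m≤m^[1+n] : ∀ m n → m ≤ m ^ suc n
m≤m^[1+n] zero    n = z≤n
m≤m^[1+n] (suc m) n = m≤m*n (suc m) (suc m ^ n) {{m^n≢0 (suc m) n}}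

floorRoot-pred : ∀ k x → 1 ≤ k → (∀ j → j ^ k ≢ x) → floorRoot k (x ∸ 1) ≡ floorRoot k x
floorRoot-pred k zero _ _ = refl
floorRoot-pred (suc k) (suc x) _ nonPower = begin
  rootSearch (suc k) x x             ≡⟨ rootSearch-suc (suc k) x x nonPower ⟩
  rootSearch (suc k) (suc x) x       ≡⟨ sym (rootSearch-reject (suc k) (suc x) x top-rejected) ⟩
  rootSearch (suc k) (suc x) (suc x) ∎
  where
  open ≡-Reasoning
  top-rejected : suc x ^ suc k ≰ suc x
  top-rejected le = nonPower (suc x) (≤-antisym le (m≤m^[1+n] (suc x) k))

^-distribʳ-* : ∀ m n k → (m * n) ^ k ≡ m ^ k * n ^ k
^-distribʳ-* m n zero = refl
^-distribʳ-* m n (suc k) = trans (cong (m * n *_) (^-distribʳ-* m n k))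
  (solve 4 (λ m n x y → (m :* n) :* (x :* y) := (m :* x) :* (n :* y)) refl m n (m ^ k) (n ^ k))

prime∣^⇒∣ : ∀ {p} m k → Prime p → p ∣ m ^ k → p ∣ m
prime∣^⇒∣ m zero pp p∣1 = contradiction (subst Prime (∣1⇒≡1 p∣1) pp) ¬prime[1]
prime∣^⇒∣ m (suc k) pp p∣m^[1+k] =
  [ id , prime∣^⇒∣ m k pp ] (euclidsLemma m (m ^ k) pp p∣m^[1+k])

^[1+m]≢2^m*odd : ∀ m n j → 1 ≤ m → j ^ suc m ≢ 2 ^ m * suc (2 * n)
^[1+m]≢2^m*odd (suc m) n j _ eq
  with prime∣^⇒∣ j (suc (suc m)) prime[2] (subst (2 ∣_) (sym eq) (∣m⇒∣m*n (suc (2 * n)) (m∣m*n (2 ^ m))))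
... | divides t refl = even≢odd (t ^ k) n (*-cancelˡ-≡ _ _ (2 ^ suc m) {{m^n≢0 2 (suc m)}} (begin
  2 ^ suc m * (2 * t ^ k)  ≡⟨ solve 2 (λ p x → p :* (con 2 :* x) := (con 2 :* p) :* x) refl (2 ^ suc m) (t ^ k) ⟩
  2 ^ k * t ^ k            ≡⟨ sym (^-distribʳ-* 2 t k) ⟩
  (2 * t) ^ k              ≡⟨ cong (_^ k) (*-comm 2 t) ⟩
  (t * 2) ^ k              ≡⟨ eq ⟩
  2 ^ suc m * suc (2 * n)  ∎))
  where
  open ≡-Reasoning
  k : ℕ
  k = suc (suc m)

lemma10 : (n k : ℕ) → 1 ≤ n → 1 < k →
    floorRoot k (2 ^ k * n + 2 ^ (k ∸ 1) ∸ 1) ≡ floorRoot k (2 ^ k * n + 2 ^ (k ∸ 1))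
lemma10 n (suc zero) _ (s≤s ())
lemma10 n (suc (suc m)) _ _ = floorRoot-pred (suc (suc m)) _ (s≤s z≤n) nonPower
  where
  factored : 2 ^ suc (suc m) * n + 2 ^ suc m ≡ 2 ^ suc m * suc (2 * n)
  factored = solve 2 (λ p n → con 2 :* p :* n :+ p := p :* (con 1 :+ con 2 :* n)) refl (2 ^ suc m) n
  nonPower : ∀ j → j ^ suc (suc m) ≢ 2 ^ suc (suc m) * n + 2 ^ suc m
  nonPower j eq = ^[1+m]≢2^m*odd (suc m) n j (s≤s z≤n) (trans eq factored)
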